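{- The factor complexities $\mathsf{p}_{\mathbf{t}_{3/2}}$ and $\mathsf{p}_{\Delta(\mathbf{t}_{3/2})}$ are both in $\Theta(n^r)$ with $r=\frac{\log 3}{\log(3/2)}$, i.e. for each of them there are constants $C_1,C_2>0$ with $C_1n^r\le \mathsf{p}(n)\le C_2 n^r$ for all $n\ge1$.
   Context: Let $\mathbf{t}_{3/2}=(t_n)_{n\ge0}\in\{0,1\}^{\mathbb{N}}$ be the unique binary sequence with $t_0=0$ such that $t_{3n}=t_{3n+1}=t_{2n}$ and $t_{3n+2}=1-t_{2n+1}$ for all $n\ge0$, and $\Delta(\mathbf{t}_{3/2})=(t_{n+1}-t_n\bmod 2)_{n\ge0}$. For an infinite word $\mathbf{x}$, $\mathsf{p}_{\mathbf{x}}(n)$ is the number of distinct length-$n$ factors of $\mathbf{x}$. -}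

module Defs where

open import Data.Bool using (Bool; true; false; not; _xor_)
open import Data.Nat using (ℕ; zero; suc; _+_; _*_; _^_; _≤_; _<_; _≥_)
open import Data.Vec using (Vec; tabulate)
open import Data.Fin using (toℕ)
open import Data.List using (List; length)
open import Data.List.Relation.Unary.All using (All)
open import Data.List.Relation.Unary.Unique.Propositional using (Unique)
open import Data.List.Membership.Propositional using (_∈_)
open import Data.Product using (Σ; ∃; _×_)
open import Relation.Binary.PropositionalEquality using (_≡_)

Word : Set
Word = ℕ → Bool

-- Characterisation of t_{3/2}: t 0 = 0, t(3n) = t(3n+1) = t(2n), t(3n+2) = 1 - t(2n+1).
-- (false = 0, true = 1.)  This sequence exists and is unique.
IsT32 : Word → Set
IsT32 t = (t 0 ≡ false)
        × (∀ n → t (3 * n) ≡ t (2 * n))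
        × (∀ n → t (3 * n + 1) ≡ t (2 * n))
        × (∀ n → t (3 * n + 2) ≡ not (t (2 * n + 1)))

Δ : Word → Word
Δ x n = x (suc n) xor x n

factorAt : Word → ℕ → (m : ℕ) → Vec Bool m
factorAt x i m = tabulate (λ j → x (i + toℕ j))

IsFactor : Word → {m : ℕ} → Vec Bool m → Set
IsFactor x {m} w = ∃ λ i → factorAt x i m ≡ w

IsComplexity : Word → ℕ → ℕ → Set
IsComplexity x m k =
  Σ (List (Vec Bool m)) λ ws →
    (length ws ≡ k) × Unique ws × All (IsFactor x) ws × (∀ i → factorAt x i m ∈ ws)

-- r = log 3 / log (3/2).  For a rational q = a/b (b ≥ 1):
--   q < r  ⇔  (3/2)^a < 3^b  ⇔  3^a < 3^b * 2^a
--   q > r  ⇔  3^b * 2^a < 3^a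
BelowR : ℕ → ℕ → Set
BelowR a b = 3 ^ a < 3 ^ b * 2 ^ a

AboveR : ℕ → ℕ → Set
AboveR a b = 3 ^ b * 2 ^ a < 3 ^ a

-- (1/K) n^r ≤ k, encoded as: n^(a/b) ≤ K k for every rational a/b < r
-- (equivalent since n ≥ 1 makes q ↦ n^q continuous and monotone).
LowerBound : ℕ → ℕ → ℕ → Set
LowerBound K n k = ∀ a b → b ≥ 1 → BelowR a b → n ^ a ≤ (K * k) ^ b

-- k ≤ K n^r, encoded as: k ≤ K n^(a/b) for every rational a/b > r.
UpperBound : ℕ → ℕ → ℕ → Set
UpperBound K n k = ∀ a b → b ≥ 1 → AboveR a b → k ^ b ≤ K ^ b * n ^ a

-- p_x ∈ Θ(n^r): ∃ C1, C2 > 0 with C1 n^r ≤ p_x(n) ≤ C2 n^r for all n ≥ 1.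
-- Real constants are replaced by C1 = 1/K1 and C2 = K2 with K1, K2 positive naturals
-- (equivalent: any positive real lies above some 1/K and below some K).
ThetaR : Word → Set
ThetaR x =
    (Σ ℕ λ K₁ → K₁ ≥ 1 × (∀ n k → n ≥ 1 → IsComplexity x n k → LowerBound K₁ n k))
  × (Σ ℕ λ K₂ → K₂ ≥ 1 × (∀ n k → n ≥ 1 → IsComplexity x n k → UpperBound K₂ n k))

-- The 3-block of a word at 3n is determined by its 2-block at 2n, and conversely; for t and Δ t this is
-- read off from the defining recurrence.  A factor of length L at position 3q + r is therefore
-- determined by r and a factor of length about 2L/3 at 2q, so p(L) ≤ 3 p(2L/3 + O(1)), whence
-- p(n) = O(3^d) when n ≈ (3/2)^d, i.e. p(n) = O(n^r).  Conversely Δ t is 0 at multiples of 3 and has a 1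
-- in each nonzero residue class within any three consecutive triples, so two occurrences of a factor of
-- length ≥ 9 (≥ 10 for t) are congruent mod 3.  Passing from an aligned agreement with shift 3b to the
-- parent agreement with shift 2b at length ≈ 2L/3 shows by induction that occurrences of a factor of
-- length ≈ 14 (3/2)^d differ by multiples of 3^d, so the factors at 0, …, 3^d - 1 are distinct and
-- p(n) ≥ 3^d.  Raising (3/2)^a ≶ 3^b to the d-th power turns both estimates into the rational-exponent
-- bounds of ThetaR.

module Submission where

open import Defs
open import Data.Bool using (Bool; true; false; not; _xor_)
open import Data.Bool.Properties using (not-injective; xor-same; not-distribˡ-xor; not-distribʳ-xor)
open import Data.Empty using (⊥; ⊥-elim)
open import Data.Fin using (toℕ; fromℕ<)
open import Data.Fin.Properties using (toℕ<n; toℕ-fromℕ<)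
open import Data.Nat
open import Data.Nat.DivMod using (_/_; _%_; m≡m%n+[m/n]*n; m%n<n; m<n*o⇒m/o<n)
open import Data.Nat.Properties
open import Data.Nat.Tactic.RingSolver using (solve-∀)
open import Data.Nat.Coprimality using (Coprime; coprime?; coprime-divisor)
open import Data.Nat.Divisibility using (_∣_; divides; 1∣_; ∣-trans; m∣m*n; *-monoʳ-∣; *-cancelˡ-∣; ∣⇒≤)
open import Data.List using (List; []; _∷_; _++_; length; map; filter; applyUpTo)
open import Data.List.Properties using (length-++; length-++-sucʳ; length-map; length-applyUpTo; filter-accept; filter-reject)
open import Data.List.Membership.Propositional using (_∈_)
open import Data.List.Membership.Propositional.Properties using (∈-map⁺; ∈-∃++; ∈-++⁻; ∈-++⁺ˡ; ∈-++⁺ʳ; ∈-applyUpTo⁻)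
open import Data.List.Relation.Binary.Subset.Propositional using (_⊆_)
open import Data.List.Relation.Unary.All as All using (All; []; _∷_)
open import Data.List.Relation.Unary.All.Properties using (all-filter)
open import Data.List.Relation.Unary.AllPairs as AllPairs using (AllPairs; []; _∷_)
import Data.List.Relation.Unary.AllPairs.Properties as AllPairs
open import Data.List.Relation.Unary.Any using (here; there)
open import Data.List.Relation.Unary.Unique.Propositional using (Unique)
open import Data.List.Relation.Unary.Unique.Propositional.Properties using (applyUpTo⁺₁)
open import Data.Sum using (_⊎_; inj₁; inj₂)
open import Data.Product using (_×_; _,_; proj₁; proj₂; ∃; ∃₂)
open import Data.Vec using (Vec; lookup)
import Data.Vec as Vec
open import Data.Vec.Properties using (tabulate-cong; lookup∘tabulate)
open import Function using (_∘_)
open import Relation.Binary.PropositionalEquality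
open import Relation.Nullary using (¬_; Dec; yes; no; contradiction)
open import Relation.Unary using (Decidable)
open import Relation.Nullary.Decidable using (from-yes)

unique-⊆⇒length≤ : ∀ {A : Set} {xs ys : List A} → Unique xs → xs ⊆ ys → length xs ≤ length ys
unique-⊆⇒length≤ {xs = []} _ _ = z≤n
unique-⊆⇒length≤ {xs = x ∷ xs} (x∉xs ∷ uxs) xs⊆ys with ys₁ , ys₂ , refl ← ∈-∃++ (xs⊆ys (here refl)) =
  subst (suc (length xs) ≤_) (sym (length-++-sucʳ ys₁ x ys₂)) (s≤s (unique-⊆⇒length≤ uxs xs⊆ys₁ys₂))
  where
  xs⊆ys₁ys₂ : xs ⊆ ys₁ ++ ys₂
  xs⊆ys₁ys₂ v∈xs with ∈-++⁻ ys₁ (xs⊆ys (there v∈xs))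
  ... | inj₁ v∈ys₁          = ∈-++⁺ˡ v∈ys₁
  ... | inj₂ (here refl)    = contradiction refl (All.lookup x∉xs v∈xs)
  ... | inj₂ (there v∈ys₂)  = ∈-++⁺ʳ ys₁ v∈ys₂

allPairs-mapWithin : ∀ {A : Set} {P : A → Set} {R S : A → A → Set} →
                     (∀ {a b} → P a → P b → R a b → S a b) →
                     ∀ {xs} → All P xs → AllPairs R xs → AllPairs S xs
allPairs-mapWithin f [] [] = []
allPairs-mapWithin f (pa ∷ pxs) (ra ∷ rxs) =
  All.zipWith (λ (pb , r) → f pa pb r) (pxs , ra) ∷ allPairs-mapWithin f pxs rxs

allVecs : ∀ n → List (Vec Bool n)
allVecs zero    = Vec.[] ∷ []
allVecs (suc n) = map (true Vec.∷_) (allVecs n) ++ map (false Vec.∷_) (allVecs n)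

length-allVecs : ∀ n → length (allVecs n) ≡ 2 ^ n
length-allVecs zero    = refl
length-allVecs (suc n) = begin
  length (map (true Vec.∷_) vs ++ map (false Vec.∷_) vs)          ≡⟨ length-++ (map (true Vec.∷_) vs) ⟩
  length (map (true Vec.∷_) vs) + length (map (false Vec.∷_) vs)  ≡⟨ cong₂ _+_ (length-map _ vs) (length-map _ vs) ⟩
  length vs + length vs                                            ≡⟨ cong₂ _+_ (length-allVecs n) (length-allVecs n) ⟩
  2 ^ n + 2 ^ n                                                    ≡⟨ cong (2 ^ n +_) (+-identityʳ (2 ^ n)) ⟨
  2 * 2 ^ n                                                        ∎
  where open ≡-Reasoning
        vs = allVecs n

∈-allVecs : ∀ {n} (v : Vec Bool n) → v ∈ allVecs n
∈-allVecs Vec.[]                 = here refl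
∈-allVecs {suc n} (true Vec.∷ v)  = ∈-++⁺ˡ (∈-map⁺ (true Vec.∷_) (∈-allVecs v))
∈-allVecs {suc n} (false Vec.∷ v) = ∈-++⁺ʳ (map (true Vec.∷_) (allVecs n)) (∈-map⁺ (false Vec.∷_) (∈-allVecs v))

coprime-^-divisor : ∀ {m n} .{{_ : NonZero m}} → Coprime m n → ∀ d {b} → m ^ d ∣ n * b → m ^ d ∣ b
coprime-^-divisor cop zero {b} _ = 1∣ b
coprime-^-divisor {m} {n} cop (suc d) {b} m^[1+d]∣nb
  with divides c refl ← coprime-divisor cop (∣-trans (m∣m*n (m ^ d)) m^[1+d]∣nb) =
  subst (m * m ^ d ∣_) (*-comm m c) (*-monoʳ-∣ m (coprime-^-divisor cop d (*-cancelˡ-∣ m m^d∣nc)))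
  where
  m^d∣nc : m * m ^ d ∣ m * (n * c)
  m^d∣nc = subst (m * m ^ d ∣_) (swap n c m) m^[1+d]∣nb
    where swap : ∀ n c m → n * (c * m) ≡ m * (n * c)
          swap = solve-∀

block-offset< : ∀ {k m s i} → s < m → i < k → k * s + i < k * m
block-offset< {k} {m} {s} {i} s<m i<k = begin-strict
  k * s + i  <⟨ +-monoʳ-< (k * s) i<k ⟩
  k * s + k  ≡⟨ +-comm (k * s) k ⟩
  k + k * s  ≡⟨ *-suc k s ⟨
  k * suc s  ≤⟨ *-monoʳ-≤ k s<m ⟩
  k * m      ∎
  where open ≤-Reasoning

n≡3[n/3]+n%3 : ∀ n → n ≡ 3 * (n / 3) + n % 3
n≡3[n/3]+n%3 n = trans (m≡m%n+[m/n]*n n 3) (trans (+-comm (n % 3) _) (cong (_+ n % 3) (*-comm (n / 3) 3)))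

3[n/3]≤n≤3[n/3]+2 : ∀ n → 3 * (n / 3) ≤ n × n ≤ 3 * (n / 3) + 2
3[n/3]≤n≤3[n/3]+2 n =
  subst (3 * (n / 3) ≤_) (sym (n≡3[n/3]+n%3 n)) (m≤m+n (3 * (n / 3)) (n % 3)) ,
  subst (_≤ 3 * (n / 3) + 2) (sym (n≡3[n/3]+n%3 n)) (+-monoʳ-≤ (3 * (n / 3)) (≤-pred (m%n<n n 3)))

nearest-residue : ∀ n r → r < 3 → ∃₂ λ j u → j < 3 × n + j ≡ 3 * u + r
nearest-residue zero r r<3 = r , 0 , r<3 , refl
nearest-residue (suc n) r r<3 with nearest-residue n r r<3
... | suc j , u , j+1<3 , eq = j , u , <-trans (n<1+n j) j+1<3 , trans (sym (+-suc n j)) eq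
... | zero  , u , _     , eq = 2 , suc u , ≤-refl , (begin
  suc n + 2        ≡⟨ +-comm (suc n) 2 ⟩
  3 + n            ≡⟨ cong (3 +_) (trans (sym (+-identityʳ n)) eq) ⟩
  3 + (3 * u + r)  ≡⟨ step u r ⟩
  3 * suc u + r    ∎)
  where open ≡-Reasoning
        step : ∀ u r → 3 + (3 * u + r) ≡ 3 * suc u + r
        step = solve-∀

residue-cases : ∀ i → i % 3 ≡ 0 ⊎ i % 3 ≡ 1 ⊎ i % 3 ≡ 2
residue-cases i with i % 3 | m%n<n i 3
... | 0 | _ = inj₁ refl
... | 1 | _ = inj₂ (inj₁ refl)
... | 2 | _ = inj₂ (inj₂ refl)
... | suc (suc (suc _)) | s≤s (s≤s (s≤s ()))

hasResidue? : ∀ r i → Dec (i % 3 ≡ r)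
hasResidue? r i = i % 3 ≟ r

residueClass : ℕ → List ℕ → List ℕ
residueClass r = filter (hasResidue? r)

length≤residueClasses : ∀ ps → length ps ≤ length (residueClass 0 ps) + length (residueClass 1 ps) + length (residueClass 2 ps)
length≤residueClasses [] = z≤n
length≤residueClasses (i ∷ ps) = subst (suc (length ps) ≤_) (sym sizes≡) (s≤s (length≤residueClasses ps))
  where
  size : ℕ → ℕ
  size r = length (residueClass r ps)
  accept : ∀ r → i % 3 ≡ r → length (residueClass r (i ∷ ps)) ≡ suc (size r)
  accept r i≡r = cong length (filter-accept (hasResidue? r) {i} {ps} i≡r)
  reject : ∀ {r} r′ → i % 3 ≡ r → r ≢ r′ → length (residueClass r′ (i ∷ ps)) ≡ size r′
  reject r′ i≡r r≢r′ = cong length (filter-reject (hasResidue? r′) {i} {ps} (λ i≡r′ → r≢r′ (trans (sym i≡r) i≡r′)))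
  sizes≡ : length (residueClass 0 (i ∷ ps)) + length (residueClass 1 (i ∷ ps)) + length (residueClass 2 (i ∷ ps))
           ≡ suc (size 0 + size 1 + size 2)
  sizes≡ with residue-cases i
  ... | inj₁ i≡0 = cong₂ _+_ (cong₂ _+_ (accept 0 i≡0) (reject 1 i≡0 λ ())) (reject 2 i≡0 λ ())
  ... | inj₂ (inj₁ i≡1) = trans (cong₂ _+_ (cong₂ _+_ (reject 0 i≡1 λ ()) (accept 1 i≡1)) (reject 2 i≡1 λ ()))
                                (cong (_+ size 2) (+-suc (size 0) (size 1)))
  ... | inj₂ (inj₂ i≡2) = trans (cong₂ _+_ (cong₂ _+_ (reject 0 i≡2 λ ()) (reject 1 i≡2 λ ())) (accept 2 i≡2))
                                (+-suc (size 0 + size 1) (size 2))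

[m*n]^o≡m^o*n^o : ∀ m n o → (m * n) ^ o ≡ m ^ o * n ^ o
[m*n]^o≡m^o*n^o m n zero    = refl
[m*n]^o≡m^o*n^o m n (suc o) = trans (cong (m * n *_) ([m*n]^o≡m^o*n^o m n o)) (reorder m n (m ^ o) (n ^ o))
  where reorder : ∀ m n a b → m * n * (a * b) ≡ m * a * (n * b)
        reorder = solve-∀

[m^n]^o≡[m^o]^n : ∀ m n o → (m ^ n) ^ o ≡ (m ^ o) ^ n
[m^n]^o≡[m^o]^n m n o = trans (^-*-assoc m n o) (trans (cong (m ^_) (*-comm n o)) (sym (^-*-assoc m o n)))

n*2^n<3^n : ∀ n → n * 2 ^ n < 3 ^ n
n*2^n<3^n 0 = from-yes (0 <? 1)
n*2^n<3^n 1 = from-yes (2 <? 3)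
n*2^n<3^n 2 = from-yes (8 <? 9)
n*2^n<3^n (suc (suc (suc n))) = begin-strict
  (3 + n) * (2 * y)        ≡⟨ reorder₁ n y ⟩
  (6 + 2 * n) * y          ≤⟨ *-monoˡ-≤ y (+-monoʳ-≤ 6 (*-monoˡ-≤ n (n≤1+n 2))) ⟩
  (6 + 3 * n) * y          ≡⟨ reorder₂ n y ⟩
  3 * ((2 + n) * y)        <⟨ *-monoʳ-< 3 (n*2^n<3^n (suc (suc n))) ⟩
  3 * 3 ^ (2 + n)          ∎
  where
  open ≤-Reasoning
  y = 2 ^ (2 + n)
  reorder₁ : ∀ n y → (3 + n) * (2 * y) ≡ (6 + 2 * n) * y
  reorder₁ = solve-∀
  reorder₂ : ∀ n y → (6 + 3 * n) * y ≡ 3 * ((2 + n) * y)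
  reorder₂ = solve-∀

3^[1+n]≰n*2^[1+n] : ∀ n → ¬ 3 ^ suc n ≤ n * 2 ^ suc n
3^[1+n]≰n*2^[1+n] n = <⇒≱ (≤-<-trans (*-monoˡ-≤ (2 ^ suc n) (n≤1+n n)) (n*2^n<3^n (suc n)))

threshold : ∀ {P : ℕ → Set} → Decidable P → P 0 → ∀ N → ¬ P N → ∃ λ d → P d × ¬ P (suc d)
threshold P? p₀ zero ¬p₀ = contradiction p₀ ¬p₀
threshold P? p₀ (suc N) ¬p₁₊N with P? N
... | yes p_N = N , p_N , ¬p₁₊N
... | no ¬p_N = threshold P? p₀ N ¬p_N

-- Agreement of factors

Agree : Word → ℕ → ℕ → ℕ → Set
Agree x L p q = ∀ i → i < L → x (p + i) ≡ x (q + i)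

module _ {x : Word} where

  agree⇒factorAt≡ : ∀ {L p q} → Agree x L p q → factorAt x p L ≡ factorAt x q L
  agree⇒factorAt≡ ag = tabulate-cong (λ j → ag (toℕ j) (toℕ<n j))

  factorAt≡⇒agree : ∀ {L p q} → factorAt x p L ≡ factorAt x q L → Agree x L p q
  factorAt≡⇒agree {L} {p} {q} eq i i<L = begin
    x (p + i)                                  ≡⟨ cong (λ k → x (p + k)) (toℕ-fromℕ< i<L) ⟨
    x (p + toℕ j)                              ≡⟨ lookup∘tabulate (λ k → x (p + toℕ k)) j ⟨
    lookup (factorAt x p L) j                  ≡⟨ cong (λ w → lookup w j) eq ⟩
    lookup (factorAt x q L) j                  ≡⟨ lookup∘tabulate (λ k → x (q + toℕ k)) j ⟩
    x (q + toℕ j)                              ≡⟨ cong (λ k → x (q + k)) (toℕ-fromℕ< i<L) ⟩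
    x (q + i)                                  ∎
    where open ≡-Reasoning
          j = fromℕ< i<L

  agree-window : ∀ {L p q} e {L′} → e + L′ ≤ L → Agree x L p q → Agree x L′ (p + e) (q + e)
  agree-window {p = p} {q} e e+L′≤L ag i i<L′ = begin
    x (p + e + i)    ≡⟨ cong x (+-assoc p e i) ⟩
    x (p + (e + i))  ≡⟨ ag (e + i) (<-≤-trans (+-monoʳ-< e i<L′) e+L′≤L) ⟩
    x (q + (e + i))  ≡⟨ cong x (+-assoc q e i) ⟨
    x (q + e + i)    ∎
    where open ≡-Reasoning

  agree-take : ∀ {L p q L′} → L′ ≤ L → Agree x L p q → Agree x L′ p q
  agree-take L′≤L ag i i<L′ = ag i (<-≤-trans i<L′ L′≤L)

  agree₂⁻ : ∀ {p q} → Agree x 2 p q → x p ≡ x q × x (p + 1) ≡ x (q + 1)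
  agree₂⁻ {p} {q} ag = trans (cong x (sym (+-identityʳ p))) (trans (ag 0 z<s) (cong x (+-identityʳ q))) , ag 1 (s<s z<s)

  agree₂⁺ : ∀ {p q} → x p ≡ x q → x (p + 1) ≡ x (q + 1) → Agree x 2 p q
  agree₂⁺ {p} {q} e₀ e₁ 0 _ = trans (cong x (+-identityʳ p)) (trans e₀ (cong x (sym (+-identityʳ q))))
  agree₂⁺ e₀ e₁ 1 _ = e₁
  agree₂⁺ e₀ e₁ (suc (suc _)) (s≤s (s≤s ()))

  agree₃⁻ : ∀ {p q} → Agree x 3 p q → x p ≡ x q × x (p + 1) ≡ x (q + 1) × x (p + 2) ≡ x (q + 2)
  agree₃⁻ {p} {q} ag = proj₁ (agree₂⁻ (agree-take (n≤1+n 2) ag)) , ag 1 (s<s z<s) , ag 2 (s<s (s<s z<s))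

  agree₃⁺ : ∀ {p q} → x p ≡ x q → x (p + 1) ≡ x (q + 1) → x (p + 2) ≡ x (q + 2) → Agree x 3 p q
  agree₃⁺ e₀ e₁ e₂ 0 _ = agree₂⁺ e₀ e₁ 0 z<s
  agree₃⁺ e₀ e₁ e₂ 1 _ = e₁
  agree₃⁺ e₀ e₁ e₂ 2 _ = e₂
  agree₃⁺ e₀ e₁ e₂ (suc (suc (suc _))) (s≤s (s≤s (s≤s ())))

  agree-Δ : ∀ {L p q} → Agree x (suc L) p q → Agree (Δ x) L p q
  agree-Δ {p = p} {q} ag i i<L = cong₂ _xor_
    (trans (cong x (sym (+-suc p i))) (trans (ag (suc i) (s≤s i<L)) (cong x (+-suc q i))))
    (ag i (m<n⇒m<1+n i<L))

  agree-blocks⁻ : ∀ {k m p q} → Agree x (k * m) p q →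
                  ∀ s → s < m → Agree x k (p + k * s) (q + k * s)
  agree-blocks⁻ {k} {m} {p} {q} ag s s<m i i<k = begin
    x (p + k * s + i)    ≡⟨ cong x (+-assoc p (k * s) i) ⟩
    x (p + (k * s + i))  ≡⟨ ag (k * s + i) (block-offset< s<m i<k) ⟩
    x (q + (k * s + i))  ≡⟨ cong x (+-assoc q (k * s) i) ⟨
    x (q + k * s + i)    ∎
    where open ≡-Reasoning

  agree-blocks⁺ : ∀ {k m p q} .{{_ : NonZero k}} →
                  (∀ s → s < m → Agree x k (p + k * s) (q + k * s)) → Agree x (k * m) p q
  agree-blocks⁺ {k} {m} {p} {q} blocks i i<km = begin
    x (p + i)              ≡⟨ cong x (split p) ⟩
    x (p + k * s + r)      ≡⟨ blocks s (m<n*o⇒m/o<n (subst (i <_) (*-comm k m) i<km)) r (m%n<n i k) ⟩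
    x (q + k * s + r)      ≡⟨ cong x (split q) ⟨
    x (q + i)              ∎
    where
    open ≡-Reasoning
    s = i / k
    r = i % k
    split : ∀ p → p + i ≡ p + k * s + r
    split p = trans (cong (p +_) (m≡m%n+[m/n]*n i k)) (reorder p r s k)
      where reorder : ∀ p r s k → p + (r + s * k) ≡ p + k * s + r
            reorder = solve-∀

  agree-lift : ∀ {k k′ m u v} .{{_ : NonZero k′}} →
               (∀ u v → Agree x k (k * u) (k * v) → Agree x k′ (k′ * u) (k′ * v)) →
               Agree x (k * m) (k * u) (k * v) → Agree x (k′ * m) (k′ * u) (k′ * v)
  agree-lift {k} {k′} {u = u} {v} lift ag = agree-blocks⁺ λ s s<m →
    subst₂ (Agree x k′) (*-distribˡ-+ k′ u s) (*-distribˡ-+ k′ v s)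
      (lift (u + s) (v + s)
        (subst₂ (Agree x k) (sym (*-distribˡ-+ k u s)) (sym (*-distribˡ-+ k v s))
          (agree-blocks⁻ ag s s<m)))

-- Block recurrences and recognizability

ChildrenDetermined : Word → Set
ChildrenDetermined x = ∀ u v → Agree x 2 (2 * u) (2 * v) → Agree x 3 (3 * u) (3 * v)

ParentsDetermined : Word → Set
ParentsDetermined x = ∀ u v → Agree x 3 (3 * u) (3 * v) → Agree x 2 (2 * u) (2 * v)

Recognizable : Word → ℕ → ℕ → Set
Recognizable x M L = ∀ {p a} → Agree x L p (p + a) → M ∣ a

Rigid : Word → ℕ → Set
Rigid x ℓ = ∀ {L} → ℓ ≤ L → Recognizable x 3 L

rigid-mono : ∀ {x ℓ ℓ′} → ℓ ≤ ℓ′ → Rigid x ℓ → Rigid x ℓ′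
rigid-mono ℓ≤ℓ′ rigid ℓ′≤L = rigid (≤-trans ℓ≤ℓ′ ℓ′≤L)

rigid-Δ : ∀ {x ℓ} → Rigid (Δ x) ℓ → Rigid x (suc ℓ)
rigid-Δ {x} rigid (s≤s ℓ≤L) ag = rigid ℓ≤L (agree-Δ {x} ag)

module _ {d : Word}
  (zeros : ∀ n → d (3 * n) ≡ false)
  (ones₁ : ∀ u → d (3 * (3 * u) + 1) ≡ true)
  (ones₂ : ∀ u → d (3 * (3 * u + 1) + 2) ≡ true) where

  one-within-three-triples : ∀ σ v → 0 < σ → σ < 3 → ∃ λ j → j < 3 × d (3 * (v + j) + σ) ≡ true
  one-within-three-triples 1 v _ _ with nearest-residue v 0 (s≤s z≤n)
  ... | j , u , j<3 , eq = j , j<3 , trans (cong (λ w → d (3 * w + 1)) (trans eq (+-identityʳ _))) (ones₁ u)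
  one-within-three-triples 2 v _ _ with nearest-residue v 1 (s≤s (s≤s z≤n))
  ... | j , u , j<3 , eq = j , j<3 , trans (cong (λ w → d (3 * w + 2)) eq) (ones₂ u)
  one-within-three-triples (suc (suc (suc _))) v _ (s≤s (s≤s (s≤s ())))

  -- A shift a ≡ ρ ≢ 0 (mod 3) would carry a 1 of d at residue σ = 3 - ρ onto a multiple of 3.
  residue-shift-absurd : ∀ {L p a b} σ ρ → 9 ≤ L → Agree d L p (p + a) →
                         σ + ρ ≡ 3 → 0 < σ → σ < 3 → a ≡ 3 * b + ρ → ⊥
  residue-shift-absurd {L} {p} {a} {b} σ ρ 9≤L ag σ+ρ≡3 0<σ σ<3 a≡ with nearest-residue p σ σ<3
  ... | e , v , e<3 , p+e≡ with one-within-three-triples σ v 0<σ σ<3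
  ... | j , j<3 , one = contradiction (begin
    true                     ≡⟨ one ⟨
    d (3 * (v + j) + σ)      ≡⟨ cong d at-one ⟨
    d (p + i)                ≡⟨ ag i i<L ⟩
    d (p + a + i)            ≡⟨ cong d at-zero ⟩
    d (3 * (v + j + b + 1))  ≡⟨ zeros (v + j + b + 1) ⟩
    false                    ∎) λ ()
    where
    open ≡-Reasoning
    i = e + 3 * j
    i<L : i < L
    i<L = ≤-trans (s≤s (+-mono-≤ (≤-pred e<3) (*-monoʳ-≤ 3 (≤-pred j<3)))) 9≤L
    at-one : p + i ≡ 3 * (v + j) + σ
    at-one = begin
      p + (e + 3 * j)    ≡⟨ +-assoc p e (3 * j) ⟨
      p + e + 3 * j      ≡⟨ cong (_+ 3 * j) p+e≡ ⟩
      3 * v + σ + 3 * j  ≡⟨ reorder v σ j ⟩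
      3 * (v + j) + σ    ∎
      where reorder : ∀ v σ j → 3 * v + σ + 3 * j ≡ 3 * (v + j) + σ
            reorder = solve-∀
    at-zero : p + a + i ≡ 3 * (v + j + b + 1)
    at-zero = begin
      p + a + i                          ≡⟨ +-comm (p + a) i ⟩
      i + (p + a)                        ≡⟨ reorder i p a ⟩
      p + i + a                          ≡⟨ cong₂ _+_ at-one a≡ ⟩
      3 * (v + j) + σ + (3 * b + ρ)      ≡⟨ collect (v + j) σ b ρ ⟩
      3 * (v + j + b) + (σ + ρ)          ≡⟨ cong (3 * (v + j + b) +_) σ+ρ≡3 ⟩
      3 * (v + j + b) + 3                ≡⟨ +-comm (3 * (v + j + b)) 3 ⟩
      3 + 3 * (v + j + b)                ≡⟨ *-suc 3 (v + j + b) ⟨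
      3 * suc (v + j + b)                ≡⟨ cong (3 *_) (+-comm 1 (v + j + b)) ⟩
      3 * (v + j + b + 1)                ∎
      where reorder : ∀ i p a → i + (p + a) ≡ p + i + a
            reorder = solve-∀
            collect : ∀ w σ b ρ → 3 * w + σ + (3 * b + ρ) ≡ 3 * (w + b) + (σ + ρ)
            collect = solve-∀

  markers⇒rigid : Rigid d 9
  markers⇒rigid {L} 9≤L {p} {a} ag with a / 3 | a % 3 | m%n<n a 3 | n≡3[n/3]+n%3 a
  ... | b | 0 | _ | a≡ = divides b (trans a≡ (trans (+-identityʳ (3 * b)) (*-comm 3 b)))
  ... | b | 1 | _ | a≡ = ⊥-elim (residue-shift-absurd {p = p} {b = b} 2 1 9≤L ag refl (s≤s z≤n) ≤-refl a≡)
  ... | b | 2 | _ | a≡ = ⊥-elim (residue-shift-absurd {p = p} {b = b} 1 2 9≤L ag refl (s≤s z≤n) (s≤s (s≤s z≤n)) a≡)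
  ... | b | suc (suc (suc _)) | s≤s (s≤s (s≤s ())) | _

-- Lower bound

-- L + 8 ≥ 14 (3/2)^d.  A window of length L contains an aligned window whose parent has length at
-- least (2L - 8)/3, which shrinks L + 8 by exactly 2/3; the factor 14 makes d = 1 force L ≥ 13.
LongEnough : ℕ → ℕ → Set
LongEnough d L = 14 * 3 ^ d ≤ (L + 8) * 2 ^ d

longEnough⇒13≤ : ∀ d {L} → LongEnough (suc d) L → 13 ≤ L
longEnough⇒13≤ d {L} long =
  +-cancelʳ-≤ 8 13 L (*-cancelˡ-≤ {21} {L + 8} 2 (*-cancelʳ-≤ (2 * 21) (2 * (L + 8)) (3 ^ d) {{m^n≢0 3 d}} (begin
  2 * 21 * 3 ^ d          ≡⟨ *-assoc 14 3 (3 ^ d) ⟩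
  14 * 3 ^ suc d          ≤⟨ long ⟩
  (L + 8) * (2 * 2 ^ d)   ≤⟨ *-monoʳ-≤ (L + 8) (*-monoʳ-≤ 2 (^-monoˡ-≤ d (n≤1+n 2))) ⟩
  (L + 8) * (2 * 3 ^ d)   ≡⟨ reorder (L + 8) (3 ^ d) ⟩
  2 * (L + 8) * 3 ^ d     ∎)))
  where open ≤-Reasoning
        reorder : ∀ a b → a * (2 * b) ≡ 2 * a * b
        reorder = solve-∀

longEnough-parent : ∀ d {L m} → LongEnough (suc d) L → L ≤ 3 * m + 4 → LongEnough d (2 * m)
longEnough-parent d {L} {m} long L≤3m+4 = *-cancelˡ-≤ 3 (begin
  3 * (14 * 3 ^ d)              ≡⟨ reorder₁ (3 ^ d) ⟩
  14 * 3 ^ suc d                ≤⟨ long ⟩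
  (L + 8) * (2 * 2 ^ d)         ≤⟨ *-monoˡ-≤ (2 * 2 ^ d) (+-monoˡ-≤ 8 L≤3m+4) ⟩
  (3 * m + 4 + 8) * (2 * 2 ^ d) ≡⟨ reorder₂ m (2 ^ d) ⟩
  3 * ((2 * m + 8) * 2 ^ d)     ∎)
  where open ≤-Reasoning
        reorder₁ : ∀ a → 3 * (14 * a) ≡ 14 * (3 * a)
        reorder₁ = solve-∀
        reorder₂ : ∀ m a → (3 * m + 4 + 8) * (2 * a) ≡ 3 * ((2 * m + 8) * a)
        reorder₂ = solve-∀

∃3m+2≤L≤3m+4 : ∀ L → 2 ≤ L → ∃ λ m → 3 * m + 2 ≤ L × L ≤ 3 * m + 4
∃3m+2≤L≤3m+4 0 ()
∃3m+2≤L≤3m+4 1 (s≤s ())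
∃3m+2≤L≤3m+4 (suc (suc L)) _ with 3m≤L , L≤3m+2 ← 3[n/3]≤n≤3[n/3]+2 L =
  L / 3 , subst (_≤ 2 + L) (+-comm 2 (3 * (L / 3))) (+-monoʳ-≤ 2 3m≤L) ,
          subst (2 + L ≤_) (reorder (3 * (L / 3))) (+-monoʳ-≤ 2 L≤3m+2)
  where reorder : ∀ a → 2 + (a + 2) ≡ a + 4
        reorder = solve-∀

longEnough? : ∀ d L → Dec (LongEnough d L)
longEnough? d L = 14 * 3 ^ d ≤? (L + 8) * 2 ^ d

longEnough-pred : ∀ d {L} → LongEnough (suc d) L → LongEnough d L
longEnough-pred d {L} long = *-cancelˡ-≤ 3 (begin
  3 * (14 * 3 ^ d)         ≡⟨ reorder₁ (3 ^ d) ⟩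
  14 * 3 ^ suc d           ≤⟨ long ⟩
  (L + 8) * (2 * 2 ^ d)    ≤⟨ *-monoʳ-≤ (L + 8) (*-monoˡ-≤ (2 ^ d) (n≤1+n 2)) ⟩
  (L + 8) * (3 * 2 ^ d)    ≡⟨ reorder₂ (L + 8) (2 ^ d) ⟩
  3 * ((L + 8) * 2 ^ d)    ∎)
  where open ≤-Reasoning
        reorder₁ : ∀ a → 3 * (14 * a) ≡ 14 * (3 * a)
        reorder₁ = solve-∀
        reorder₂ : ∀ b a → b * (3 * a) ≡ 3 * (b * a)
        reorder₂ = solve-∀

¬longEnough⇒bound : ∀ D {n} → ¬ LongEnough D n → n * 2 ^ D ≤ 14 * 3 ^ D
¬longEnough⇒bound D {n} ¬long = <⇒≤ (≤-<-trans (*-monoˡ-≤ (2 ^ D) (m≤m+n n 8)) (≰⇒> ¬long))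

¬longEnough-far : ∀ n → ¬ LongEnough (n + 9) n
¬longEnough-far n long = <⇒≱ (begin-strict
  (n + 8) * 2 ^ N    <⟨ *-monoˡ-< (2 ^ N) {{m^n≢0 2 N}} (+-monoʳ-< n ≤-refl) ⟩
  N * 2 ^ N          <⟨ n*2^n<3^n N ⟩
  3 ^ N              ≤⟨ m≤m+n (3 ^ N) (13 * 3 ^ N) ⟩
  14 * 3 ^ N         ∎) long
  where open ≤-Reasoning
        N = n + 9

module _ {x : Word} (parents : ParentsDetermined x) where

  parent-agreement : ∀ {L p b m} → 3 * m + 2 ≤ L → Agree x L p (p + b * 3) →
                     ∃ λ u → Agree x (2 * m) (2 * u) (2 * u + 2 * b)
  parent-agreement {L} {p} {b} {m} 3m+2≤L ag with nearest-residue p 0 (s≤s z≤n)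
  ... | e , u , e<3 , p+e≡3u = u , subst (Agree x (2 * m) (2 * u)) (*-distribˡ-+ 2 u b) (agree-lift {x} {3} {2} {m} {u} {u + b} parents aligned)
    where
    e+3m≤L : e + 3 * m ≤ L
    e+3m≤L = ≤-trans (subst (e + 3 * m ≤_) (+-comm 2 (3 * m)) (+-monoˡ-≤ (3 * m) (≤-pred e<3))) 3m+2≤L
    shifted : p + b * 3 + e ≡ 3 * (u + b)
    shifted = begin
      p + b * 3 + e      ≡⟨ reorder p b e ⟩
      p + e + b * 3      ≡⟨ cong (_+ b * 3) p+e≡3u ⟩
      3 * u + 0 + b * 3  ≡⟨ collect u b ⟩
      3 * (u + b)        ∎
      where open ≡-Reasoning
            reorder : ∀ p b e → p + b * 3 + e ≡ p + e + b * 3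
            reorder = solve-∀
            collect : ∀ u b → 3 * u + 0 + b * 3 ≡ 3 * (u + b)
            collect = solve-∀
    aligned : Agree x (3 * m) (3 * u) (3 * (u + b))
    aligned = subst₂ (Agree x (3 * m)) (trans p+e≡3u (+-identityʳ (3 * u))) shifted
                (agree-window {x} e e+3m≤L ag)

  module _ (rigid : Rigid x 13) where

    longEnough⇒recognizable : ∀ d {L} → LongEnough d L → Recognizable x (3 ^ d) L
    longEnough⇒recognizable zero _ {a = a} _ = 1∣ a
    longEnough⇒recognizable (suc d) {L} long {p} {a} ag = descend (rigid 13≤L ag) ag
      where
      13≤L = longEnough⇒13≤ d long
      descend : 3 ∣ a → Agree x L p (p + a) → 3 ^ suc d ∣ a
      descend (divides b refl) ag′ =
        let m , 3m+2≤L , L≤3m+4 = ∃3m+2≤L≤3m+4 L (≤-trans (s≤s (s≤s z≤n)) 13≤L)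
            u , parents-agree   = parent-agreement {L} {p} {b} {m} 3m+2≤L ag′
            3^d∣2b              = longEnough⇒recognizable d {2 * m} (longEnough-parent d {L} {m} long L≤3m+4) {2 * u} {2 * b} parents-agree
        in subst (3 * 3 ^ d ∣_) (*-comm 3 b) (*-monoʳ-∣ 3 (coprime-^-divisor (from-yes (coprime? 3 2)) d {b} 3^d∣2b))

recognizable⇒complexity≥ : ∀ {x M n k} → Recognizable x M n → IsComplexity x n k → M ≤ k
recognizable⇒complexity≥ {x} {M} {n} recognizable (ws , refl , _ , _ , complete) =
  subst (_≤ length ws) (length-applyUpTo factor M)
    (unique-⊆⇒length≤ (applyUpTo⁺₁ factor M distinct) prefixes⊆ws)
  where
  factor = λ i → factorAt x i n
  distinct : ∀ {i j} → i < j → j < M → factor i ≢ factor j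
  distinct {i} {j} i<j j<M eq = <⇒≱ (≤-<-trans (m∸n≤m j i) j<M) (∣⇒≤ {{>-nonZero (m<n⇒0<n∸m i<j)}} M∣j∸i)
    where M∣j∸i = recognizable (subst (Agree x n i) (sym (m+[n∸m]≡n (<⇒≤ i<j))) (factorAt≡⇒agree {x} eq))
  prefixes⊆ws : applyUpTo factor M ⊆ ws
  prefixes⊆ws v∈ with i , _ , refl ← ∈-applyUpTo⁻ factor v∈ = complete i

lower-bracket : ∀ {x n k} → ParentsDetermined x → Rigid x 13 → IsComplexity x n k →
                ∃ λ d → 3 ^ d ≤ k × n * 2 ^ suc d ≤ 14 * 3 ^ suc d
lower-bracket {x} {n} parents rigid complexity with longEnough? 0 n
... | no ¬long₀ =
  0 , recognizable⇒complexity≥ {x} (λ {_} {a} _ → 1∣ a) complexity ,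
  ¬longEnough⇒bound 1 {n} (¬long₀ ∘ longEnough-pred 0 {n})
... | yes long₀ with threshold (λ d → longEnough? d n) long₀ (n + 9) (¬longEnough-far n)
... | d , long , ¬long =
  d , recognizable⇒complexity≥ {x} (longEnough⇒recognizable {x} parents rigid d long) complexity ,
  ¬longEnough⇒bound (suc d) {n} ¬long

-- Upper bound

Distinct : Word → ℕ → List ℕ → Set
Distinct x L = AllPairs (λ i j → ¬ Agree x L i j)

FactorBound : Word → ℕ → ℕ → Set
FactorBound x L B = ∀ ps → Distinct x L ps → length ps ≤ B

factorBound-2^ : ∀ x L → FactorBound x L (2 ^ L)
factorBound-2^ x L ps distinct = begin
  length ps                       ≡⟨ length-map factor ps ⟨
  length (map factor ps)          ≤⟨ unique-⊆⇒length≤ unique (λ {v} _ → ∈-allVecs v) ⟩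
  length (allVecs L)              ≡⟨ length-allVecs L ⟩
  2 ^ L                           ∎
  where
  open ≤-Reasoning
  factor = λ i → factorAt x i L
  unique : Unique (map factor ps)
  unique = AllPairs.map⁺ (AllPairs.map (λ ¬ag eq → ¬ag (factorAt≡⇒agree {x} eq)) distinct)

-- L - 8 ≤ (3/2)^d.  A window of length L lies in an aligned window whose parent has length at most
-- (2L + 8)/3, which shrinks L - 8 by exactly 2/3.
ShortEnough : ℕ → ℕ → Set
ShortEnough d L = L * 2 ^ d ≤ 3 ^ d + 8 * 2 ^ d

shortEnough-parent : ∀ d {L m} → ShortEnough (suc d) L → 3 * m ≤ L + 4 → ShortEnough d (2 * m)
shortEnough-parent d {L} {m} short 3m≤L+4 = *-cancelˡ-≤ 3 (begin
  3 * (2 * m * 2 ^ d)                  ≡⟨ reorder₁ m (2 ^ d) ⟩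
  3 * m * (2 * 2 ^ d)                  ≤⟨ *-monoˡ-≤ (2 * 2 ^ d) 3m≤L+4 ⟩
  (L + 4) * (2 * 2 ^ d)                ≡⟨ reorder₂ L (2 ^ d) ⟩
  L * (2 * 2 ^ d) + 8 * 2 ^ d          ≤⟨ +-monoˡ-≤ (8 * 2 ^ d) short ⟩
  3 ^ suc d + 8 * 2 ^ suc d + 8 * 2 ^ d ≡⟨ reorder₃ (3 ^ d) (2 ^ d) ⟩
  3 * (3 ^ d + 8 * 2 ^ d)              ∎)
  where open ≤-Reasoning
        reorder₁ : ∀ m a → 3 * (2 * m * a) ≡ 3 * m * (2 * a)
        reorder₁ = solve-∀
        reorder₂ : ∀ L a → (L + 4) * (2 * a) ≡ L * (2 * a) + 8 * a
        reorder₂ = solve-∀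
        reorder₃ : ∀ b a → 3 * b + 8 * (2 * a) + 8 * a ≡ 3 * (b + 8 * a)
        reorder₃ = solve-∀

module _ {x : Word} (children : ChildrenDetermined x) where

  parent : ℕ → ℕ
  parent i = 2 * (i / 3)

  agree-from-parents : ∀ {L m i j} → L + 2 ≤ 3 * m → i % 3 ≡ j % 3 →
                       Agree x (2 * m) (parent i) (parent j) → Agree x L i j
  agree-from-parents {L} {m} {i} {j} L+2≤3m i≡j ag =
    subst₂ (Agree x L) (sym (n≡3[n/3]+n%3 i)) (trans (cong (3 * (j / 3) +_) i≡j) (sym (n≡3[n/3]+n%3 j)))
      (agree-window {x} (i % 3) r+L≤3m (agree-lift {x} {2} {3} {m} {i / 3} {j / 3} children ag))
    where
    r+L≤3m : i % 3 + L ≤ 3 * m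
    r+L≤3m = ≤-trans (subst (i % 3 + L ≤_) (+-comm 2 L) (+-monoˡ-≤ L (≤-pred (m%n<n i 3)))) L+2≤3m

  factorBound-step : ∀ {L m B} → L + 2 ≤ 3 * m → FactorBound x (2 * m) B → FactorBound x L (3 * B)
  factorBound-step {L} {m} {B} L+2≤3m bound ps distinct = begin
    length ps                          ≤⟨ length≤residueClasses ps ⟩
    size 0 + size 1 + size 2           ≤⟨ +-mono-≤ (+-mono-≤ (class≤B 0) (class≤B 1)) (class≤B 2) ⟩
    B + B + B                          ≡⟨ triple B ⟩
    3 * B                              ∎
    where
    open ≤-Reasoning
    size = λ r → length (residueClass r ps)
    triple : ∀ B → B + B + B ≡ 3 * B
    triple = solve-∀
    class≤B : ∀ r → size r ≤ B
    class≤B r = subst (_≤ B) (length-map parent (residueClass r ps))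
      (bound (map parent (residueClass r ps)) (AllPairs.map⁺
        (allPairs-mapWithin (λ ≡r ≡r′ ¬ag ag → ¬ag (agree-from-parents {L} {m} L+2≤3m (trans ≡r (sym ≡r′)) ag))
          (all-filter (hasResidue? r) ps) (AllPairs.filter⁺ (hasResidue? r) distinct))))

  factorBound : ∀ d {L} → ShortEnough d L → FactorBound x L (2 ^ 9 * 3 ^ d)
  factorBound zero {L} short ps distinct =
    ≤-trans (factorBound-2^ x L ps distinct) (^-monoʳ-≤ 2 (subst (_≤ 9) (*-identityʳ L) short))
  factorBound (suc d) {L} short =
    subst (FactorBound x L) (reorder (3 ^ d)) (factorBound-step {L} {m} L+2≤3m (factorBound d (shortEnough-parent d {L} {m} short 3m≤L+4)))
    where
    m = (L + 4) / 3
    3m≤L+4 = proj₁ (3[n/3]≤n≤3[n/3]+2 (L + 4))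
    L+2≤3m : L + 2 ≤ 3 * m
    L+2≤3m = +-cancelʳ-≤ 2 (L + 2) (3 * m) (subst₂ _≤_ (sym (+-assoc L 2 2)) refl (proj₂ (3[n/3]≤n≤3[n/3]+2 (L + 4))))
    reorder : ∀ a → 3 * (2 ^ 9 * a) ≡ 2 ^ 9 * (3 * a)
    reorder = solve-∀

positions : ∀ {x n} {ws : List (Vec Bool n)} → All (IsFactor x) ws → ∃ λ ps → map (λ i → factorAt x i n) ps ≡ ws
positions [] = [] , refl
positions {x} ((i , refl) ∷ occurs) with ps , refl ← positions {x} occurs = i ∷ ps , refl

factorBound⇒complexity≤ : ∀ {x n k B} → FactorBound x n B → IsComplexity x n k → k ≤ B
factorBound⇒complexity≤ {x} {n} {B = B} bound (ws , refl , unique , occurs , _) with ps , refl ← positions {x} occurs =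
  subst (_≤ B) (sym (length-map factor ps))
    (bound ps (AllPairs.map (λ ≢ ag → ≢ (agree⇒factorAt≡ {x} ag)) (AllPairs.map⁻ unique)))
  where factor = λ i → factorAt x i n

upper-bracket : ∀ {x n k} → ChildrenDetermined x → 1 ≤ n → IsComplexity x n k →
                ∃ λ d → k ≤ 1536 * 3 ^ d × 3 ^ d ≤ n * 2 ^ d
upper-bracket {x} {n} children 1≤n complexity
  with threshold (λ d → 3 ^ d ≤? n * 2 ^ d) (subst (1 ≤_) (sym (*-identityʳ n)) 1≤n) (suc n) (3^[1+n]≰n*2^[1+n] n)
... | d , fits , ¬fits = d , ≤-trans (factorBound⇒complexity≤ {x} (factorBound {x} children (suc d) short) complexity)
                                    (≤-reflexive (sym (*-assoc 512 3 (3 ^ d)))) , fits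
  where short : ShortEnough (suc d) n
        short = ≤-trans (<⇒≤ (≰⇒> ¬fits)) (m≤m+n (3 ^ suc d) (8 * 2 ^ suc d))

-- Rational exponents

-- Both follow by raising the defining inequality to the power D and exchanging exponents.
belowR-^ : ∀ {a b} D → BelowR a b → (3 ^ D) ^ a ≤ (3 ^ D) ^ b * (2 ^ D) ^ a
belowR-^ {a} {b} D below = begin
  (3 ^ D) ^ a                ≡⟨ [m^n]^o≡[m^o]^n 3 D a ⟩
  (3 ^ a) ^ D                ≤⟨ ^-monoˡ-≤ D (<⇒≤ below) ⟩
  (3 ^ b * 2 ^ a) ^ D        ≡⟨ [m*n]^o≡m^o*n^o (3 ^ b) (2 ^ a) D ⟩
  (3 ^ b) ^ D * (2 ^ a) ^ D  ≡⟨ cong₂ _*_ ([m^n]^o≡[m^o]^n 3 b D) ([m^n]^o≡[m^o]^n 2 a D) ⟩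
  (3 ^ D) ^ b * (2 ^ D) ^ a  ∎
  where open ≤-Reasoning

aboveR-^ : ∀ {a b} D → AboveR a b → (3 ^ D) ^ b * (2 ^ D) ^ a ≤ (3 ^ D) ^ a
aboveR-^ {a} {b} D above = begin
  (3 ^ D) ^ b * (2 ^ D) ^ a  ≡⟨ cong₂ _*_ ([m^n]^o≡[m^o]^n 3 D b) ([m^n]^o≡[m^o]^n 2 D a) ⟩
  (3 ^ b) ^ D * (2 ^ a) ^ D  ≡⟨ [m*n]^o≡m^o*n^o (3 ^ b) (2 ^ a) D ⟨
  (3 ^ b * 2 ^ a) ^ D        ≤⟨ ^-monoˡ-≤ D (<⇒≤ above) ⟩
  (3 ^ a) ^ D                ≡⟨ [m^n]^o≡[m^o]^n 3 D a ⟨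
  (3 ^ D) ^ a                ∎
  where open ≤-Reasoning

-- (3/2)^3 > 3, so a/b < log 3 / log (3/2) forces a ≤ 3b.
belowR⇒a≤3b : ∀ {a b} → BelowR a b → a ≤ 3 * b
belowR⇒a≤3b {a} {b} below with a ≤? 3 * b
... | yes a≤3b = a≤3b
... | no a≰3b = contradiction below (≤⇒≯ (begin
  3 ^ b * 2 ^ a              ≡⟨ cong (λ e → 3 ^ b * 2 ^ e) a≡ ⟩
  3 ^ b * 2 ^ (3 * b + c)    ≡⟨ split ⟩
  (3 * 8) ^ b * 2 ^ c        ≤⟨ *-mono-≤ (^-monoˡ-≤ b (m≤m+n 24 3)) (^-monoˡ-≤ c (n≤1+n 2)) ⟩
  27 ^ b * 3 ^ c             ≡⟨ cong (_* 3 ^ c) (^-*-assoc 3 3 b) ⟩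
  3 ^ (3 * b) * 3 ^ c        ≡⟨ ^-distribˡ-+-* 3 (3 * b) c ⟨
  3 ^ (3 * b + c)            ≡⟨ cong (3 ^_) a≡ ⟨
  3 ^ a                      ∎))
  where
  open ≤-Reasoning
  c = a ∸ 3 * b
  a≡ : a ≡ 3 * b + c
  a≡ = sym (m+[n∸m]≡n (<⇒≤ (≰⇒> a≰3b)))
  split : 3 ^ b * 2 ^ (3 * b + c) ≡ (3 * 8) ^ b * 2 ^ c
  split = begin-equality
    3 ^ b * 2 ^ (3 * b + c)      ≡⟨ cong (3 ^ b *_) (^-distribˡ-+-* 2 (3 * b) c) ⟩
    3 ^ b * (2 ^ (3 * b) * 2 ^ c) ≡⟨ cong (λ e → 3 ^ b * (e * 2 ^ c)) (^-*-assoc 2 3 b) ⟨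
    3 ^ b * (8 ^ b * 2 ^ c)      ≡⟨ *-assoc (3 ^ b) (8 ^ b) (2 ^ c) ⟨
    3 ^ b * 8 ^ b * 2 ^ c        ≡⟨ cong (_* 2 ^ c) ([m*n]^o≡m^o*n^o 3 8 b) ⟨
    (3 * 8) ^ b * 2 ^ c          ∎

lower-exponent : ∀ {n k D a b} → 3 ^ D ≤ 3 * k → n * 2 ^ D ≤ 14 * 3 ^ D → BelowR a b → n ^ a ≤ (8232 * k) ^ b
lower-exponent {n} {k} {D} {a} {b} 3^D≤3k n2^D≤14·3^D below = begin
  n ^ a                      ≤⟨ *-cancelʳ-≤ (n ^ a) (14 ^ a * (3 ^ D) ^ b) ((2 ^ D) ^ a) {{m^n≢0 (2 ^ D) a {{m^n≢0 2 D}}}} scaled ⟩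
  14 ^ a * (3 ^ D) ^ b       ≤⟨ *-mono-≤ (^-monoʳ-≤ 14 (belowR⇒a≤3b {a} {b} below)) (^-monoˡ-≤ b 3^D≤3k) ⟩
  14 ^ (3 * b) * (3 * k) ^ b ≡⟨ cong (_* (3 * k) ^ b) (^-*-assoc 14 3 b) ⟨
  2744 ^ b * (3 * k) ^ b     ≡⟨ [m*n]^o≡m^o*n^o 2744 (3 * k) b ⟨
  (2744 * (3 * k)) ^ b       ≡⟨ cong (_^ b) (*-assoc 2744 3 k) ⟨
  (8232 * k) ^ b             ∎
  where
  open ≤-Reasoning
  scaled : n ^ a * (2 ^ D) ^ a ≤ 14 ^ a * (3 ^ D) ^ b * (2 ^ D) ^ a
  scaled = begin
    n ^ a * (2 ^ D) ^ a                ≡⟨ [m*n]^o≡m^o*n^o n (2 ^ D) a ⟨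
    (n * 2 ^ D) ^ a                    ≤⟨ ^-monoˡ-≤ a n2^D≤14·3^D ⟩
    (14 * 3 ^ D) ^ a                   ≡⟨ [m*n]^o≡m^o*n^o 14 (3 ^ D) a ⟩
    14 ^ a * (3 ^ D) ^ a               ≤⟨ *-monoʳ-≤ (14 ^ a) (belowR-^ {a} {b} D below) ⟩
    14 ^ a * ((3 ^ D) ^ b * (2 ^ D) ^ a) ≡⟨ *-assoc (14 ^ a) _ _ ⟨
    14 ^ a * (3 ^ D) ^ b * (2 ^ D) ^ a ∎

upper-exponent : ∀ {n k d a b} → k ≤ 1536 * 3 ^ d → 3 ^ d ≤ n * 2 ^ d → AboveR a b → k ^ b ≤ 1536 ^ b * n ^ a
upper-exponent {n} {k} {d} {a} {b} k≤ 3^d≤n2^d above = begin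
  k ^ b                      ≤⟨ ^-monoˡ-≤ b k≤ ⟩
  (1536 * 3 ^ d) ^ b         ≡⟨ [m*n]^o≡m^o*n^o 1536 (3 ^ d) b ⟩
  1536 ^ b * (3 ^ d) ^ b     ≤⟨ *-monoʳ-≤ (1536 ^ b) (*-cancelʳ-≤ ((3 ^ d) ^ b) (n ^ a) ((2 ^ d) ^ a) {{m^n≢0 (2 ^ d) a {{m^n≢0 2 d}}}} scaled) ⟩
  1536 ^ b * n ^ a           ∎
  where
  open ≤-Reasoning
  scaled : (3 ^ d) ^ b * (2 ^ d) ^ a ≤ n ^ a * (2 ^ d) ^ a
  scaled = begin
    (3 ^ d) ^ b * (2 ^ d) ^ a  ≤⟨ aboveR-^ {a} {b} d above ⟩
    (3 ^ d) ^ a                ≤⟨ ^-monoˡ-≤ a 3^d≤n2^d ⟩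
    (n * 2 ^ d) ^ a            ≡⟨ [m*n]^o≡m^o*n^o n (2 ^ d) a ⟩
    n ^ a * (2 ^ d) ^ a        ∎

thetaR : ∀ {x} → ChildrenDetermined x → ParentsDetermined x → Rigid x 13 → ThetaR x
thetaR {x} children parents rigid =
  (8232 , s≤s z≤n , λ n k _ complexity a b _ below →
    let d , 3^d≤k , n-bound = lower-bracket {x} parents rigid complexity
    in lower-exponent {n} {k} {suc d} {a} {b} (*-monoʳ-≤ 3 3^d≤k) n-bound below) ,
  (1536 , s≤s z≤n , λ n k 1≤n complexity a b _ above →
    let d , k-bound , fits = upper-bracket {x} children 1≤n complexity
    in upper-exponent {n} {k} {d} {a} {b} k-bound fits above)

-- The word t_{3/2} and its difference sequence

module _ (t : Word) (t32 : IsT32 t) where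

  -- The initial value t 0 is never used: complementing a word does not change its complexity.
  private
    t[3n]   = proj₁ (proj₂ t32)
    t[3n+1] = proj₁ (proj₂ (proj₂ t32))
    t[3n+2] = proj₂ (proj₂ (proj₂ t32))

  t32-children : ChildrenDetermined t
  t32-children u v ag = let e₀ , e₁ = agree₂⁻ {t} ag in agree₃⁺ {t}
    (trans (t[3n] u) (trans e₀ (sym (t[3n] v))))
    (trans (t[3n+1] u) (trans e₀ (sym (t[3n+1] v))))
    (trans (t[3n+2] u) (trans (cong not e₁) (sym (t[3n+2] v))))

  t32-parents : ParentsDetermined t
  t32-parents u v ag = let f₀ , _ , f₂ = agree₃⁻ {t} ag in agree₂⁺ {t}
    (trans (sym (t[3n] u)) (trans f₀ (t[3n] v)))
    (not-injective (trans (sym (t[3n+2] u)) (trans f₂ (t[3n+2] v))))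

  Δt[3n] : ∀ n → Δ t (3 * n) ≡ false
  Δt[3n] n = trans (cong₂ _xor_ (trans (cong t (+-comm 1 (3 * n))) (t[3n+1] n)) (t[3n] n)) (xor-same (t (2 * n)))

  Δt[3n+1] : ∀ n → Δ t (3 * n + 1) ≡ not (Δ t (2 * n))
  Δt[3n+1] n = begin
    t (suc (3 * n + 1)) xor t (3 * n + 1)  ≡⟨ cong₂ _xor_ (trans (cong t (sym (+-suc (3 * n) 1))) (t[3n+2] n)) (t[3n+1] n) ⟩
    not (t (2 * n + 1)) xor t (2 * n)      ≡⟨ not-distribˡ-xor (t (2 * n + 1)) (t (2 * n)) ⟨
    not (t (2 * n + 1) xor t (2 * n))      ≡⟨ cong (λ m → not (t m xor t (2 * n))) (+-comm (2 * n) 1) ⟩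
    not (Δ t (2 * n))                      ∎
    where open ≡-Reasoning

  Δt[3n+2] : ∀ n → Δ t (3 * n + 2) ≡ not (Δ t (2 * n + 1))
  Δt[3n+2] n = begin
    t (suc (3 * n + 2)) xor t (3 * n + 2)      ≡⟨ cong₂ _xor_ (trans (cong t (next₃ n)) (t[3n] (suc n))) (t[3n+2] n) ⟩
    t (2 * suc n) xor not (t (2 * n + 1))      ≡⟨ not-distribʳ-xor (t (2 * suc n)) (t (2 * n + 1)) ⟨
    not (t (2 * suc n) xor t (2 * n + 1))      ≡⟨ cong (λ m → not (t m xor t (2 * n + 1))) (next₂ n) ⟩
    not (Δ t (2 * n + 1))                      ∎
    where open ≡-Reasoning
          next₃ : ∀ n → suc (3 * n + 2) ≡ 3 * suc n
          next₃ = solve-∀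
          next₂ : ∀ n → 2 * suc n ≡ suc (2 * n + 1)
          next₂ = solve-∀

  Δt-children : ChildrenDetermined (Δ t)
  Δt-children u v ag = let e₀ , e₁ = agree₂⁻ {Δ t} ag in agree₃⁺ {Δ t}
    (trans (Δt[3n] u) (sym (Δt[3n] v)))
    (trans (Δt[3n+1] u) (trans (cong not e₀) (sym (Δt[3n+1] v))))
    (trans (Δt[3n+2] u) (trans (cong not e₁) (sym (Δt[3n+2] v))))

  Δt-parents : ParentsDetermined (Δ t)
  Δt-parents u v ag = let _ , f₁ , f₂ = agree₃⁻ {Δ t} ag in agree₂⁺ {Δ t}
    (not-injective (trans (sym (Δt[3n+1] u)) (trans f₁ (Δt[3n+1] v))))
    (not-injective (trans (sym (Δt[3n+2] u)) (trans f₂ (Δt[3n+2] v))))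

  Δt-rigid : Rigid (Δ t) 9
  Δt-rigid = markers⇒rigid {Δ t} Δt[3n] ones₁ ones₂
    where
    ones₁ : ∀ u → Δ t (3 * (3 * u) + 1) ≡ true
    ones₁ u = trans (Δt[3n+1] (3 * u)) (cong not (trans (cong (Δ t) (swap u)) (Δt[3n] (2 * u))))
      where swap : ∀ u → 2 * (3 * u) ≡ 3 * (2 * u)
            swap = solve-∀
    ones₂ : ∀ u → Δ t (3 * (3 * u + 1) + 2) ≡ true
    ones₂ u = trans (Δt[3n+2] (3 * u + 1)) (cong not (trans (cong (Δ t) (swap u)) (Δt[3n] (2 * u + 1))))
      where swap : ∀ u → 2 * (3 * u + 1) + 1 ≡ 3 * (2 * u + 1)
            swap = solve-∀

corollary16 : (t : Word) → IsT32 t → ThetaR t × ThetaR (Δ t)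
corollary16 t t32 =
  thetaR {t} (t32-children t t32) (t32-parents t t32) (rigid-mono {t} (from-yes (10 ≤? 13)) (rigid-Δ {t} (Δt-rigid t t32))) ,
  thetaR {Δ t} (Δt-children t t32) (Δt-parents t t32) (rigid-mono {Δ t} (from-yes (9 ≤? 13)) (Δt-rigid t t32))
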